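{- Let $n>1$ be an integer and consider $$f_{n,1}(x)=\sum_{j\geq 0}\binom{n-1}{2j+1}(x^j-x^{j+1})\in\mathbb{F}_2[x]$$ (coefficients reduced modulo $2$). Then $f_{n,1}(x)$ is self-reciprocal if and only if $n$ is even.
   Context: Binomial coefficients $\binom{a}{b}$ are $0$ when $b>a$. A nonzero polynomial $f(x)$ of (actual) degree $d\ge0$ is self-reciprocal if $x^d f(1/x)=f(x)$; the zero polynomial is not self-reciprocal. -}

module Defs where

open import Data.Nat using (ℕ; zero; suc; _+_; _*_; _∸_; _≤_; _<_; _%_)
open import Data.Nat.Combinatorics using (_C_)
open import Data.Integer using (ℤ; +_; _-_; ∣_∣)
open import Data.Product using (Σ; _×_)
open import Relation.Binary.PropositionalEquality using (_≡_; _≢_)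

-- Polynomials over 𝔽₂ are represented by their coefficient sequences
-- ℕ → ℕ, where the coefficient of x^k is an element of {0,1} (residues mod 2).
Poly𝔽₂ : Set
Poly𝔽₂ = ℕ → ℕ

-- c n j = binom(n-1, 2j+1), the integer coefficient in front of (x^j - x^{j+1}).
c : ℕ → ℕ → ℕ
c n j = (n ∸ 1) C (2 * j + 1)

-- Integer coefficient of x^k in  Σ_j c n j (x^j - x^{j+1}) :  c_k - c_{k-1}  (c_{-1} = 0).
fZ : ℕ → ℕ → ℤ
fZ n zero    = + c n zero
fZ n (suc k) = + c n (suc k) - + c n k

f : ℕ → Poly𝔽₂
f n k = ∣ fZ n k ∣ % 2

HasDegree : Poly𝔽₂ → ℕ → Set
HasDegree p d = (p d ≢ 0) × (∀ k → d < k → p k ≡ 0)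

-- p is self-reciprocal: p is nonzero of degree d and x^d p(1/x) = p(x),
-- i.e. the coefficient of x^k equals that of x^(d-k) for all k ≤ d
-- (coefficients above d vanish on both sides).
SelfReciprocal : Poly𝔽₂ → Set
SelfReciprocal p = Σ ℕ λ d → HasDegree p d × (∀ k → k ≤ d → p k ≡ p (d ∸ k))

-- Modulo 2, binom(2a+r, 2b+s) ≡ binom(a, b) · binom(r, s) for r, s ∈ {0, 1} (the last digit of
-- Lucas' theorem), and in 𝔽₂ the coefficient of x^k in f_{n,1} is c_k + c_{k-1}. For odd n
-- every c_j = binom(n-1, 2j+1) is even, so f_{n,1} = 0, which has no degree. For n = 2m every
-- c_j ≡ binom(m-1, j), so by Pascal's rule f_{n,1} is the row of binomial coefficients
-- binom(m, k) mod 2, which is self-reciprocal of degree m.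
module Submission where

open import Defs
open import Data.Nat using (ℕ; zero; suc; _+_; _*_; _∸_; _%_; _<_; parity)
open import Data.Nat.Properties using (+-suc; +-identityʳ; +-comm; *-comm; n≮0)
open import Data.Nat.Combinatorics using (_C_; nCk+nC[k+1]≡[n+1]C[k+1]; nCn≡1; nCk≡nC[n∸k]; k>n⇒nCk≡0)
open import Data.Nat.Divisibility using (_∣_; divides)
open import Data.Integer using (+_; _-_; _⊖_; ∣_∣)
open import Data.Integer.Properties using ([+m]-[+n]≡m⊖n; [1+m]⊖[1+n]≡m⊖n)
open import Data.Parity.Base as ℙ using (Parity; 0ℙ; 1ℙ)
open import Data.Parity.Properties as ℙₚ using (p+p≡0ℙ; +-homo-+; *-homo-*; *-zeroʳ)
open import Data.Empty using (⊥-elim)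
open import Data.Product using (_,_)
open import Function.Base using (_∘_)
open import Function.Bundles using (_⇔_; mk⇔)
open import Relation.Nullary using (¬_)
open import Relation.Binary.PropositionalEquality

open ≡-Reasoning

double : ℕ → ℕ
double zero    = zero
double (suc n) = suc (suc (double n))

double≡2* : ∀ n → double n ≡ 2 * n
double≡2* zero    = refl
double≡2* (suc n) = cong suc (begin
  suc (double n)      ≡⟨ cong suc (double≡2* n) ⟩
  suc (n + (n + 0))   ≡⟨ +-suc n (n + 0) ⟨
  n + suc (n + 0)     ∎)

data EvenOrOdd : ℕ → Set where
  even : ∀ h → EvenOrOdd (double h)
  odd  : ∀ h → EvenOrOdd (suc (double h))

evenOrOdd : ∀ n → EvenOrOdd n
evenOrOdd zero = even zero
evenOrOdd (suc n) with evenOrOdd n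
... | even h = odd h
... | odd h  = even (suc h)

parity-double : ∀ n → parity (double n) ≡ 0ℙ
parity-double zero    = refl
parity-double (suc n) = parity-double n

2∣⇒parity≡0ℙ : ∀ {n} → 2 ∣ n → parity n ≡ 0ℙ
2∣⇒parity≡0ℙ (divides q refl) = trans (*-homo-* q 2) (*-zeroʳ (parity q))

2∤1+2n : ∀ n → ¬ 2 ∣ suc (double n)
2∤1+2n n 2∣1+2n = ℙₚ.p≢p⁻¹ 1ℙ (begin
  1ℙ                         ≡⟨ cong (1ℙ ℙ.+_) (parity-double n) ⟨
  1ℙ ℙ.+ parity (double n)   ≡⟨ +-homo-+ 1 (double n) ⟨
  parity (suc (double n))    ≡⟨ 2∣⇒parity≡0ℙ 2∣1+2n ⟩
  0ℙ                         ∎)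

bit : Parity → ℕ
bit 0ℙ = 0
bit 1ℙ = 1

n%2≡bit[parity[n]] : ∀ n → n % 2 ≡ bit (parity n)
n%2≡bit[parity[n]] zero          = refl
n%2≡bit[parity[n]] (suc zero)    = refl
n%2≡bit[parity[n]] (suc (suc n)) = n%2≡bit[parity[n]] n

parity∣m⊖n∣≡parity[m+n] : ∀ m n → parity ∣ m ⊖ n ∣ ≡ parity (m + n)
parity∣m⊖n∣≡parity[m+n] m       zero    = cong parity (sym (+-identityʳ m))
parity∣m⊖n∣≡parity[m+n] zero    (suc n) = refl
parity∣m⊖n∣≡parity[m+n] (suc m) (suc n) = begin
  parity ∣ suc m ⊖ suc n ∣     ≡⟨ cong (λ i → parity ∣ i ∣) ([1+m]⊖[1+n]≡m⊖n m n) ⟩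
  parity ∣ m ⊖ n ∣             ≡⟨ parity∣m⊖n∣≡parity[m+n] m n ⟩
  parity (suc (suc (m + n)))   ≡⟨ cong (λ i → parity (suc i)) (+-suc m n) ⟨
  parity (suc m + suc n)       ∎

parity-pascal : ∀ n k → parity (suc n C suc k) ≡ parity (n C k) ℙ.+ parity (n C suc k)
parity-pascal n k = begin
  parity (suc n C suc k)           ≡⟨ cong parity (nCk+nC[k+1]≡[n+1]C[k+1] n k) ⟨
  parity (n C k + n C suc k)       ≡⟨ +-homo-+ (n C k) (n C suc k) ⟩
  parity (n C k) ℙ.+ parity (n C suc k) ∎

parity[2aC[1+2b]]≡0ℙ              : ∀ a b → parity (double a C suc (double b)) ≡ 0ℙ
parity[2aC2b]≡parity[aCb]         : ∀ a b → parity (double a C double b) ≡ parity (a C b)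
parity[[1+2a]C[1+2b]]≡parity[aCb] : ∀ a b → parity (suc (double a) C suc (double b)) ≡ parity (a C b)
parity[[1+2a]C2b]≡parity[aCb]     : ∀ a b → parity (suc (double a) C double b) ≡ parity (a C b)

parity[2aC[1+2b]]≡0ℙ zero    b = refl
parity[2aC[1+2b]]≡0ℙ (suc a) b = begin
  parity (suc (suc (double a)) C suc (double b))    ≡⟨ parity-pascal (suc (double a)) (double b) ⟩
  parity (suc (double a) C double b) ℙ.+ parity (suc (double a) C suc (double b))
    ≡⟨ cong₂ ℙ._+_ (parity[[1+2a]C2b]≡parity[aCb] a b) (parity[[1+2a]C[1+2b]]≡parity[aCb] a b) ⟩
  parity (a C b) ℙ.+ parity (a C b)                 ≡⟨ p+p≡0ℙ (parity (a C b)) ⟩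
  0ℙ                                                ∎

parity[2aC2b]≡parity[aCb] zero    zero    = refl
parity[2aC2b]≡parity[aCb] zero    (suc b) = refl
parity[2aC2b]≡parity[aCb] (suc a) zero    = refl
parity[2aC2b]≡parity[aCb] (suc a) (suc b) = begin
  parity (suc (suc (double a)) C suc (suc (double b)))  ≡⟨ parity-pascal (suc (double a)) (suc (double b)) ⟩
  parity (suc (double a) C suc (double b)) ℙ.+ parity (suc (double a) C double (suc b))
    ≡⟨ cong₂ ℙ._+_ (parity[[1+2a]C[1+2b]]≡parity[aCb] a b) (parity[[1+2a]C2b]≡parity[aCb] a (suc b)) ⟩
  parity (a C b) ℙ.+ parity (a C suc b)                 ≡⟨ parity-pascal a b ⟨
  parity (suc a C suc b)                                ∎

parity[[1+2a]C[1+2b]]≡parity[aCb] zero    zero    = refl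
parity[[1+2a]C[1+2b]]≡parity[aCb] zero    (suc b) = refl
parity[[1+2a]C[1+2b]]≡parity[aCb] (suc a) b       = begin
  parity (suc (double (suc a)) C suc (double b))   ≡⟨ parity-pascal (double (suc a)) (double b) ⟩
  parity (double (suc a) C double b) ℙ.+ parity (double (suc a) C suc (double b))
    ≡⟨ cong₂ ℙ._+_ (parity[2aC2b]≡parity[aCb] (suc a) b) (parity[2aC[1+2b]]≡0ℙ (suc a) b) ⟩
  parity (suc a C b) ℙ.+ 0ℙ                        ≡⟨ ℙₚ.+-identityʳ (parity (suc a C b)) ⟩
  parity (suc a C b)                               ∎

parity[[1+2a]C2b]≡parity[aCb] zero    zero    = refl
parity[[1+2a]C2b]≡parity[aCb] zero    (suc b) = refl
parity[[1+2a]C2b]≡parity[aCb] (suc a) zero    = refl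
parity[[1+2a]C2b]≡parity[aCb] (suc a) (suc b) = begin
  parity (suc (double (suc a)) C suc (suc (double b)))  ≡⟨ parity-pascal (double (suc a)) (suc (double b)) ⟩
  parity (double (suc a) C suc (double b)) ℙ.+ parity (double (suc a) C double (suc b))
    ≡⟨ cong₂ ℙ._+_ (parity[2aC[1+2b]]≡0ℙ (suc a) b) (parity[2aC2b]≡parity[aCb] (suc a) (suc b)) ⟩
  0ℙ ℙ.+ parity (suc a C suc b)                         ≡⟨ ℙₚ.+-identityˡ (parity (suc a C suc b)) ⟩
  parity (suc a C suc b)                                ∎

binomialRow : ℕ → Poly𝔽₂
binomialRow m k = (m C k) % 2

SelfReciprocal-resp-≗ : ∀ {p q} → p ≗ q → SelfReciprocal p → SelfReciprocal q
SelfReciprocal-resp-≗ p≗q (d , (pd≢0 , p-vanishes) , p-symmetric) =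
  d , ((λ qd≡0 → pd≢0 (trans (p≗q d) qd≡0)) , λ k d<k → trans (sym (p≗q k)) (p-vanishes k d<k))
    , λ k k≤d → trans (sym (p≗q k)) (trans (p-symmetric k k≤d) (p≗q (d ∸ k)))

¬SelfReciprocal[0] : ∀ {p} → (∀ k → p k ≡ 0) → ¬ SelfReciprocal p
¬SelfReciprocal[0] p≗0 (d , (pd≢0 , _) , _) = pd≢0 (p≗0 d)

SelfReciprocal[binomialRow] : ∀ m → SelfReciprocal (binomialRow m)
SelfReciprocal[binomialRow] m =
  m , (subst (λ x → x % 2 ≢ 0) (sym (nCn≡1 m)) (λ ()) , λ k m<k → cong (_% 2) (k>n⇒nCk≡0 m<k))
    , λ k k≤m → cong (_% 2) (nCk≡nC[n∸k] k≤m)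

-- f_{n,1} with coefficients in Parity ≅ 𝔽₂, where −1 = 1.
fℙ : ℕ → ℕ → Parity
fℙ n zero    = parity (c n zero)
fℙ n (suc k) = parity (c n (suc k)) ℙ.+ parity (c n k)

f≡bit[fℙ] : ∀ n k → f n k ≡ bit (fℙ n k)
f≡bit[fℙ] n zero    = n%2≡bit[parity[n]] (c n zero)
f≡bit[fℙ] n (suc k) = begin
  ∣ + c n (suc k) - + c n k ∣ % 2              ≡⟨ cong (λ i → ∣ i ∣ % 2) ([+m]-[+n]≡m⊖n (c n (suc k)) (c n k)) ⟩
  ∣ c n (suc k) ⊖ c n k ∣ % 2                  ≡⟨ n%2≡bit[parity[n]] ∣ c n (suc k) ⊖ c n k ∣ ⟩
  bit (parity ∣ c n (suc k) ⊖ c n k ∣)          ≡⟨ cong bit (parity∣m⊖n∣≡parity[m+n] (c n (suc k)) (c n k)) ⟩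
  bit (parity (c n (suc k) + c n k))            ≡⟨ cong bit (+-homo-+ (c n (suc k)) (c n k)) ⟩
  bit (fℙ n (suc k))                            ∎

c≡[n∸1]C[1+2j] : ∀ n j → c n j ≡ (n ∸ 1) C suc (double j)
c≡[n∸1]C[1+2j] n j = cong (λ i → (n ∸ 1) C i) (begin
  2 * j + 1       ≡⟨ +-comm (2 * j) 1 ⟩
  suc (2 * j)     ≡⟨ cong suc (double≡2* j) ⟨
  suc (double j)  ∎)

parity[c[1+2h]]≡0ℙ : ∀ h j → parity (c (suc (double h)) j) ≡ 0ℙ
parity[c[1+2h]]≡0ℙ h j = trans (cong parity (c≡[n∸1]C[1+2j] (suc (double h)) j)) (parity[2aC[1+2b]]≡0ℙ h j)

parity[c[2+2h]]≡parity[hC] : ∀ h j → parity (c (double (suc h)) j) ≡ parity (h C j)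
parity[c[2+2h]]≡parity[hC] h j =
  trans (cong parity (c≡[n∸1]C[1+2j] (double (suc h)) j)) (parity[[1+2a]C[1+2b]]≡parity[aCb] h j)

fℙ[1+2h]≡0ℙ : ∀ h k → fℙ (suc (double h)) k ≡ 0ℙ
fℙ[1+2h]≡0ℙ h zero    = parity[c[1+2h]]≡0ℙ h zero
fℙ[1+2h]≡0ℙ h (suc k) = cong₂ ℙ._+_ (parity[c[1+2h]]≡0ℙ h (suc k)) (parity[c[1+2h]]≡0ℙ h k)

fℙ[2+2h]≡parity[[1+h]C] : ∀ h k → fℙ (double (suc h)) k ≡ parity (suc h C k)
fℙ[2+2h]≡parity[[1+h]C] h zero    = parity[c[2+2h]]≡parity[hC] h zero
fℙ[2+2h]≡parity[[1+h]C] h (suc k) = begin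
  parity (c (double (suc h)) (suc k)) ℙ.+ parity (c (double (suc h)) k)
    ≡⟨ cong₂ ℙ._+_ (parity[c[2+2h]]≡parity[hC] h (suc k)) (parity[c[2+2h]]≡parity[hC] h k) ⟩
  parity (h C suc k) ℙ.+ parity (h C k)   ≡⟨ ℙₚ.+-comm (parity (h C suc k)) (parity (h C k)) ⟩
  parity (h C k) ℙ.+ parity (h C suc k)   ≡⟨ parity-pascal h k ⟨
  parity (suc h C suc k)                  ∎

f[1+2h]≡0 : ∀ h k → f (suc (double h)) k ≡ 0
f[1+2h]≡0 h k = trans (f≡bit[fℙ] _ k) (cong bit (fℙ[1+2h]≡0ℙ h k))

f[2+2h]≗binomialRow : ∀ h → f (double (suc h)) ≗ binomialRow (suc h)
f[2+2h]≗binomialRow h k = begin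
  f (double (suc h)) k        ≡⟨ f≡bit[fℙ] _ k ⟩
  bit (fℙ (double (suc h)) k) ≡⟨ cong bit (fℙ[2+2h]≡parity[[1+h]C] h k) ⟩
  bit (parity (suc h C k))    ≡⟨ n%2≡bit[parity[n]] (suc h C k) ⟨
  binomialRow (suc h) k       ∎

theorem4p1 : (n : ℕ) → 1 < n → SelfReciprocal (f n) ⇔ (2 ∣ n)
theorem4p1 n 1<n with evenOrOdd n
... | even zero    = ⊥-elim (n≮0 1<n)
... | even (suc h) = mk⇔
  (λ _ → divides (suc h) (trans (double≡2* (suc h)) (*-comm 2 (suc h))))
  (λ _ → SelfReciprocal-resp-≗ (sym ∘ f[2+2h]≗binomialRow h) (SelfReciprocal[binomialRow] (suc h)))
... | odd h        = mk⇔
  (λ sr → ⊥-elim (¬SelfReciprocal[0] (f[1+2h]≡0 h) sr))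
  (λ 2∣n → ⊥-elim (2∤1+2n h 2∣n))
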